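{- The augmented cube $AQ_4$ is fractional strongly maximally matched and fractional strongly super matched.
   Context: $G-F$ deletes the vertices and edges of $F\subseteq V(G)\cup E(G)$; $\delta(G)$ is the minimum degree. A fractional perfect matching is $f:E(G)\to[0,1]$ with $\sum_{e\ni v}f(e)=1$ for all vertices $v$. $F$ is a fractional strong matching preclusion (FSMP) set if $G-F$ has no fractional perfect matching; $fsmp(G)$ is the minimum size of an FSMP set; optimal means $|F|=fsmp(G)$. $G$ is fractional strongly maximally matched if $fsmp(G)=\delta(G)$, and fractional strongly super matched if moreover $G-F$ has an isolated vertex for every optimal FSMP set $F$. The augmented cube $AQ_n$: vertices are $n$-bit binary strings; $AQ_1\cong K_2$; for $n\geq2$, take copies $AQ^0_{n-1},AQ^1_{n-1}$ of $AQ_{n-1}$ (prefixes $0$, $1$) and join $0u_1\cdots u_{n-1}$ to $1v_1\cdots v_{n-1}$ iff $u_i=v_i$ for all $i$ or $u_i\neq v_i$ for all $i$. $AQ_4$ is $7$-regular on $16$ vertices.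
   Formalization: The values of a fractional perfect matching are taken in the rationals lying in $[0,1]$. -}

module Defs where

open import Data.Nat using (ℕ; zero; suc; _≤_; _+_)
open import Data.Bool using (Bool; true; false; not; _∧_; _∨_; if_then_else_; T)
open import Data.Vec using (Vec; []; _∷_; map)
open import Data.List using (List; []; _∷_; _++_; length; foldr)
import Data.List as L
open import Data.List.Membership.Propositional using (_∈_)
open import Data.List.Relation.Unary.Unique.Propositional using (Unique)
open import Data.Product using (Σ; ∃; _×_; _,_)
open import Relation.Nullary using (¬_; Dec; yes; no)
open import Relation.Binary.PropositionalEquality using (_≡_)
open import Data.Rational using (ℚ; 0ℚ; 1ℚ) renaming (_≤_ to _≤ℚ_; _+_ to _+ℚ_)

V : ℕ → Set
V n = Vec Bool n

allV : (n : ℕ) → List (V n)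
allV zero = [] ∷ []
allV (suc n) = L.map (false ∷_) (allV n) ++ L.map (true ∷_) (allV n)

eqB : Bool → Bool → Bool
eqB true true = true
eqB false false = true
eqB _ _ = false

eqV : ∀ {n} → V n → V n → Bool
eqV [] [] = true
eqV (a ∷ u) (b ∷ v) = eqB a b ∧ eqV u v

-- For n = 1 this gives K_2 on {0,1}; for n ≥ 2, within a copy
-- (same first bit) use AQ_{n-1}, across copies join 0u to 1v iff
-- u = v or u is the bitwise complement of v.

adjB : (n : ℕ) → V n → V n → Bool
adjB zero [] [] = false
adjB (suc n) (a ∷ u) (b ∷ v) =
  if eqB a b then adjB n u v else (eqV u v ∨ eqV u (map not v))

Adj : (n : ℕ) → V n → V n → Set
Adj n u v = T (adjB n u v)

degree : (n : ℕ) → V n → ℕ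
degree n v = length (L.filter (λ u → Data.Bool._≟_ (adjB n v u) true) (allV n))
  where import Data.Bool

IsMinDegree : (n : ℕ) → ℕ → Set
IsMinDegree n d = (∀ v → d ≤ degree n v) × (∃ λ v → degree n v ≡ d)

-- Lexicographic strict order, used to store each (undirected) edge once

ltV : ∀ {n} → V n → V n → Bool
ltV [] [] = false
ltV (a ∷ u) (b ∷ v) = (not a ∧ b) ∨ (eqB a b ∧ ltV u v)

-- A set F ⊆ V(AQ_n) ∪ E(AQ_n): a duplicate-free list of vertices and a
-- duplicate-free list of edges, each edge {u,v} stored once as (u , v)
-- with u < v.
record FaultSet (n : ℕ) : Set where
  field
    vs      : List (V n)
    es      : List (V n × V n)
    vsUniq  : Unique vs
    esUniq  : Unique es
    esEdges : ∀ {u v} → (u , v) ∈ es → Adj n u v × T (ltV u v)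
open FaultSet public

size : ∀ {n} → FaultSet n → ℕ
size F = length (vs F) + length (es F)

Alive : ∀ {n} → FaultSet n → V n → Set
Alive F v = ¬ (v ∈ vs F)

EdgeIn : (n : ℕ) → FaultSet n → V n → V n → Set
EdgeIn n F u v = Adj n u v × Alive F u × Alive F v
                 × ¬ ((u , v) ∈ es F) × ¬ ((v , u) ∈ es F)

sumℚ : List ℚ → ℚ
sumℚ = foldr _+ℚ_ 0ℚ

-- A fractional perfect matching of AQ_n - F, encoded as a symmetric
-- weight function on ordered pairs, supported on the edges of G - F,
-- with values in [0,1] and weight sum 1 at every surviving vertex.
record FracPerfectMatching (n : ℕ) (F : FaultSet n) : Set where
  field
    f       : V n → V n → ℚ
    symm    : ∀ u v → f u v ≡ f v u
    lower   : ∀ u v → 0ℚ ≤ℚ f u v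
    upper   : ∀ u v → f u v ≤ℚ 1ℚ
    support : ∀ u v → ¬ EdgeIn n F u v → f u v ≡ 0ℚ
    perfect : ∀ v → Alive F v → sumℚ (L.map (f v) (allV n)) ≡ 1ℚ

IsFSMP : (n : ℕ) → FaultSet n → Set
IsFSMP n F = ¬ FracPerfectMatching n F

IsFsmpNumber : (n : ℕ) → ℕ → Set
IsFsmpNumber n k =
  (Σ (FaultSet n) λ F → IsFSMP n F × size F ≡ k)
  × (∀ F → IsFSMP n F → k ≤ size F)

HasIsolatedVertex : (n : ℕ) → FaultSet n → Set
HasIsolatedVertex n F = ∃ λ v → Alive F v × (∀ u → ¬ EdgeIn n F v u)

FracStronglyMaximallyMatched : ℕ → Set
FracStronglyMaximallyMatched n = ∃ λ k → IsFsmpNumber n k × IsMinDegree n k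

FracStronglySuperMatched : ℕ → Set
FracStronglySuperMatched n =
  ∃ λ k → IsFsmpNumber n k × IsMinDegree n k
        × (∀ F → IsFSMP n F → size F ≡ k → HasIsolatedVertex n F)

-- A fractional perfect matching of G - F exists as soon as the bipartite double cover of G - F satisfies
-- Hall's condition: a perfect matching of the double cover is a permutation σ of the surviving vertices
-- along edges, and f(u,v) = ½[σu = v] + ½[σv = u] is fractional perfect.  If Hall's condition fails for X,
-- then I = X ∖ N(X) has all its G - F neighbours in S = N(X) ∖ X, where |S| < |I|.  So F must contain every
-- edge of AQ_n inside I and, for each vertex of N(I) ∖ (I ∪ S), that vertex or an edge joining it to I:
-- |F| ≥ e(I) + |N(I) ∖ I| - |S|.  Checking all 2^16 vertex sets of AQ_4 gives e(I) + |N(I) ∖ I| ≥ |I| + 6,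
-- and ≥ |I| + 7 when |I| ≥ 2; hence |F| ≥ 7 = δ(AQ_4), with equality only if I is a single vertex and
-- S = ∅, i.e. G - F has an isolated vertex.  Deleting the neighbours of a vertex attains 7.

module Submission where

open import Defs
open import Data.Product using (_×_)

open import Algebra.Bundles using (CommutativeMonoid)
open import Data.Bool using (Bool; true; false; not; _∧_; if_then_else_; T)
open import Data.Bool.Properties using (T?; T-≡; ∧-conicalˡ; ∧-conicalʳ) renaming (_≟_ to _≟ᵇ_)
open import Data.Empty using (⊥; ⊥-elim)
open import Data.Fin using (Fin; zero; suc; combine; finToFun; funToFin)
open import Data.Fin.Properties
  using (2↔Bool; finToFun-funToFin; funToFin-finToFin; any?; all?; suc-injective; 0≢1+n) renaming (_≟_ to _≟ᶠ_)
open import Data.Fin.Subset using (Subset; inside; outside; ∣_∣; _∪_; _∩_; _─_; _-_; ⁅_⁆; _⊆_; Nonempty; Empty)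
  renaming (_∈_ to _∈ₛ_; _∉_ to _∉ₛ_; ⊥ to ∅)
open import Data.Fin.Subset.Properties
  using (_⊆?_; anySubset?; nonempty?; drop-there; Empty-unique; ∣⊥∣≡0; ∣p∣≤n; ∣⁅x⁆∣≡1; p⊆q⇒∣p∣≤∣q∣;
         x∈p∩q⁺; x∈p∩q⁻; x∈p∪q⁺; x∈p∪q⁻; x∈⁅x⁆; x∈⁅y⁆⇒x≡y; x∉⁅y⁆⇒x≢y; x∈p∧x≢y⇒x∈p-y; x∈p∧x∉q⇒x∈p─q;
         p─q⊆p; p∩q≢∅⇒∣p─q∣<∣p∣; x∈p⇒∣p-x∣<∣p∣; p─⊥≡p; ∩-comm; ⊆-antisym; ⊆-trans; ∉⊥)
  renaming (_∈?_ to _∈ₛ?_)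
open import Data.List using (List; []; _∷_; _++_; length; filter)
import Data.List as List
open import Data.List.Membership.Propositional using (_∈_)
open import Data.List.Membership.Propositional.Properties
  using (∈-map⁺; ∈-map⁻; ∈-++⁺ˡ; ∈-++⁺ʳ; ∈-filter⁺; ∈-filter⁻)
open import Data.List.Properties using (map-cong; filter-all; length-++; length-map)
open import Data.List.Relation.Unary.All using (All)
import Data.List.Relation.Unary.All as All
import Data.List.Relation.Unary.AllPairs as AllPairs
import Data.List.Relation.Unary.Any as Any
open import Data.List.Relation.Unary.Unique.Propositional using (Unique)
import Data.List.Relation.Unary.Unique.Propositional.Properties as Unique
open import Data.Nat using (ℕ; zero; suc; _+_; _^_; _≤_; _<_; z≤n; s≤s; _≤?_; _<?_; _≤ᵇ_)
open import Data.Nat.Properties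
  using (≤-trans; ≤-reflexive; ≤-pred; ≤-<-trans; <-irrefl; n≤1+n; m≤m+n; m≤n⇒m≤1+n; ≰⇒>; ≮⇒≥; ≤ᵇ⇒≤; _≟_;
         +-suc; +-identityʳ; +-assoc; +-comm; +-mono-≤; +-monoʳ-≤; +-monoˡ-≤; +-cancelʳ-≤; +-cancelʳ-<;
         module ≤-Reasoning)
open import Data.Product using (∃; _,_; proj₁; proj₂)
open import Data.Product.Properties using () renaming (≡-dec to ×-≡-dec)
open import Data.Rational using (ℚ; 0ℚ; 1ℚ; ½) renaming (_+_ to _+ℚ_; _≤_ to _≤ℚ_)
import Data.Rational.Properties as ℚ
open import Data.Sum using (_⊎_; inj₁; inj₂; [_,_]′)
open import Data.Unit using (tt)
open import Data.Vec using (Vec; []; _∷_; lookup; tabulate; map; allFin; here; there)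
open import Data.Vec.Properties
  using (lookup∘tabulate; tabulate∘lookup; tabulate-cong; lookup-allFin; []=⇒lookup; lookup⇒[]=; ≡-dec)
open import Function using (_∘_; Inverse; Equivalence; case_of_; mk⇔)
open import Relation.Binary.PropositionalEquality
open import Relation.Nullary using (¬_; Dec; yes; no; does)
open import Relation.Nullary.Decidable using (_×-dec_; _⊎-dec_; ¬?; toWitness; dec-true; dec-false; does-⇔)

bit : Fin 2 → Bool
bit = Inverse.to 2↔Bool

vertex : ∀ {n} → Fin (2 ^ n) → V n
vertex i = tabulate (bit ∘ finToFun i)

index : ∀ {n} → V n → Fin (2 ^ n)
index v = funToFin (Inverse.from 2↔Bool ∘ lookup v)

funToFin-cong : ∀ {m n} {f g : Fin m → Fin n} → (∀ i → f i ≡ g i) → funToFin f ≡ funToFin g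
funToFin-cong {zero} f≗g = refl
funToFin-cong {suc m} f≗g = cong₂ combine (f≗g zero) (funToFin-cong (f≗g ∘ suc))

vertex-index : ∀ {n} (v : V n) → vertex (index v) ≡ v
vertex-index v = trans (tabulate-cong bits) (tabulate∘lookup v)
  where
  bits : ∀ k → bit (finToFun (index v) k) ≡ lookup v k
  bits k = trans (cong bit (finToFun-funToFin _ k)) (Inverse.strictlyInverseˡ 2↔Bool (lookup v k))

index-vertex : ∀ {n} (i : Fin (2 ^ n)) → index {n} (vertex i) ≡ i
index-vertex {n} i = trans (funToFin-cong digits) (funToFin-finToFin {n} {2} i)
  where
  digits : ∀ k → Inverse.from 2↔Bool (lookup (vertex {n} i) k) ≡ finToFun i k
  digits k = trans (cong (Inverse.from 2↔Bool) (lookup∘tabulate _ k))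
                   (Inverse.strictlyInverseʳ 2↔Bool (finToFun i k))

vertex-injective : ∀ {n} {i j : Fin (2 ^ n)} → vertex {n} i ≡ vertex j → i ≡ j
vertex-injective {n} {i} {j} eq =
  trans (sym (index-vertex {n} i)) (trans (cong index eq) (index-vertex {n} j))

allV-complete : ∀ {n} (v : V n) → v ∈ allV n
allV-complete [] = Any.here refl
allV-complete (false ∷ v) = ∈-++⁺ˡ (∈-map⁺ (false ∷_) (allV-complete v))
allV-complete {suc n} (true ∷ v) =
  ∈-++⁺ʳ (List.map (false ∷_) (allV n)) (∈-map⁺ (true ∷_) (allV-complete v))

allV-unique : ∀ n → Unique (allV n)
allV-unique zero = All.[] AllPairs.∷ AllPairs.[]
allV-unique (suc n) = Unique.++⁺ (prefixed false) (prefixed true) halves-disjoint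
  where
  prefixed : ∀ b → Unique (List.map (b ∷_) (allV n))
  prefixed b = Unique.map⁺ (λ { refl → refl }) (allV-unique n)
  halves-disjoint : ∀ {v} → ¬ (v ∈ List.map (false ∷_) (allV n) × v ∈ List.map (true ∷_) (allV n))
  halves-disjoint (f∈ , t∈) with ∈-map⁻ (false ∷_) f∈ | ∈-map⁻ (true ∷_) t∈
  ... | _ , _ , refl | _ , _ , ()

eqB-sym : ∀ a b → eqB a b ≡ eqB b a
eqB-sym true true = refl
eqB-sym true false = refl
eqB-sym false true = refl
eqB-sym false false = refl

eqV-sym : ∀ {n} (u v : V n) → eqV u v ≡ eqV v u
eqV-sym [] [] = refl
eqV-sym (a ∷ u) (b ∷ v) = cong₂ _∧_ (eqB-sym a b) (eqV-sym u v)

eqV-complement-sym : ∀ {n} (u v : V n) → eqV u (map not v) ≡ eqV v (map not u)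
eqV-complement-sym [] [] = refl
eqV-complement-sym (a ∷ u) (b ∷ v) = cong₂ _∧_ (flip-bit a b) (eqV-complement-sym u v)
  where
  flip-bit : ∀ a b → eqB a (not b) ≡ eqB b (not a)
  flip-bit true true = refl
  flip-bit true false = refl
  flip-bit false true = refl
  flip-bit false false = refl

adjB-sym : ∀ n (u v : V n) → adjB n u v ≡ adjB n v u
adjB-sym zero [] [] = refl
adjB-sym (suc n) (a ∷ u) (b ∷ v)
  rewrite eqB-sym a b | adjB-sym n u v | eqV-sym u v | eqV-complement-sym u v = refl

adjB-irrefl : ∀ n (v : V n) → adjB n v v ≡ false
adjB-irrefl zero [] = refl
adjB-irrefl (suc n) (true ∷ v) = adjB-irrefl n v
adjB-irrefl (suc n) (false ∷ v) = adjB-irrefl n v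

_≟ⱽ_ : ∀ {n} (u v : V n) → Dec (u ≡ v)
_≟ⱽ_ = ≡-dec _≟ᵇ_

module _ {n : ℕ} (F : FaultSet n) where

  faultyVertex? : ∀ v → Dec (v ∈ vs F)
  faultyVertex? v = v ∈? vs F
    where open import Data.List.Membership.DecPropositional (_≟ⱽ_ {n}) using (_∈?_)

  faultyEdge? : ∀ e → Dec (e ∈ es F)
  faultyEdge? e = e ∈? es F
    where open import Data.List.Membership.DecPropositional (×-≡-dec (_≟ⱽ_ {n}) (_≟ⱽ_ {n})) using (_∈?_)

  alive? : ∀ v → Dec (Alive F v)
  alive? v = ¬? (faultyVertex? v)

  edgeIn? : ∀ u v → Dec (EdgeIn n F u v)
  edgeIn? u v = T? (adjB n u v) ×-dec alive? u ×-dec alive? v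
                ×-dec ¬? (faultyEdge? (u , v)) ×-dec ¬? (faultyEdge? (v , u))

  EdgeIn-sym : ∀ {u v} → EdgeIn n F u v → EdgeIn n F v u
  EdgeIn-sym {u} {v} (uv , u-alive , v-alive , uv∉ , vu∉) =
    subst T (adjB-sym n u v) uv , v-alive , u-alive , vu∉ , uv∉

-- Fractional perfect matchings

sumℚ-zero : ∀ {A : Set} (g : A → ℚ) {xs} → All (λ x → g x ≡ 0ℚ) xs → sumℚ (List.map g xs) ≡ 0ℚ
sumℚ-zero g All.[] = refl
sumℚ-zero g (gx≡0 All.∷ rest) rewrite gx≡0 | sumℚ-zero g rest = refl

sumℚ-+ : ∀ {A : Set} (g h : A → ℚ) xs →
         sumℚ (List.map (λ x → g x +ℚ h x) xs) ≡ sumℚ (List.map g xs) +ℚ sumℚ (List.map h xs)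
sumℚ-+ g h [] = refl
sumℚ-+ g h (x ∷ xs) =
  trans (cong ((g x +ℚ h x) +ℚ_) (sumℚ-+ g h xs)) (interchange (g x) (h x) _ _)
  where open import Algebra.Properties.CommutativeSemigroup
          (CommutativeMonoid.commutativeSemigroup ℚ.+-0-commutativeMonoid) using (interchange)

sumℚ-point : ∀ {n} (w : V n) q {xs} → Unique xs → w ∈ xs →
             sumℚ (List.map (λ u → if does (u ≟ⱽ w) then q else 0ℚ) xs) ≡ q
sumℚ-point w q (w∉xs AllPairs.∷ _) (Any.here refl)
  rewrite dec-true (w ≟ⱽ w) refl
        | sumℚ-zero (λ u → if does (u ≟ⱽ w) then q else 0ℚ)
                    (All.map (λ w≢u → cong (if_then q else 0ℚ) (dec-false (_ ≟ⱽ w) (w≢u ∘ sym))) w∉xs)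
  = ℚ.+-identityʳ q
sumℚ-point w q (x∉xs AllPairs.∷ unique) (Any.there w∈xs)
  rewrite dec-false (_ ≟ⱽ w) (All.lookup x∉xs w∈xs) = trans (ℚ.+-identityˡ _) (sumℚ-point w q unique w∈xs)

record EdgePermutation (n : ℕ) (F : FaultSet n) : Set where
  field
    σ            : V n → V n
    σ-edge       : ∀ {v} → Alive F v → EdgeIn n F v (σ v)
    σ-injective  : ∀ {u v} → Alive F u → Alive F v → σ u ≡ σ v → u ≡ v
    σ-surjective : ∀ {v} → Alive F v → ∃ λ u → Alive F u × σ u ≡ v

weight : Bool → ℚ
weight b = if b then ½ else 0ℚ

0≤weight : ∀ b → 0ℚ ≤ℚ weight b
0≤weight true = toWitness {a? = 0ℚ ℚ.≤? ½} _
0≤weight false = ℚ.≤-refl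

weight≤½ : ∀ b → weight b ≤ℚ ½
weight≤½ true = ℚ.≤-refl
weight≤½ false = toWitness {a? = 0ℚ ℚ.≤? ½} _

-- Each surviving vertex sends ½ to its image and receives ½ from its unique preimage.
EdgePermutation⇒FPM : ∀ {n F} → EdgePermutation n F → FracPerfectMatching n F
EdgePermutation⇒FPM {n} {F} π = record
  { f       = f
  ; symm    = λ u v → ℚ.+-comm (weight (sends u v)) (weight (sends v u))
  ; lower   = λ u v → ℚ.+-mono-≤ (0≤weight (sends u v)) (0≤weight (sends v u))
  ; upper   = λ u v → ℚ.+-mono-≤ (weight≤½ (sends u v)) (weight≤½ (sends v u))
  ; support = λ u v ¬uv → cong₂ _+ℚ_ (cong weight (no-send ¬uv))
                                    (cong weight (no-send (¬uv ∘ EdgeIn-sym F)))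
  ; perfect = perfect
  }
  where
  open EdgePermutation π

  sends : V n → V n → Bool
  sends u v = does (alive? F u ×-dec σ u ≟ⱽ v)

  f : V n → V n → ℚ
  f u v = weight (sends u v) +ℚ weight (sends v u)

  no-send : ∀ {u v} → ¬ EdgeIn n F u v → sends u v ≡ false
  no-send {u} {v} ¬uv = dec-false (alive? F u ×-dec σ u ≟ⱽ v) λ { (u-alive , refl) → ¬uv (σ-edge u-alive) }

  perfect : ∀ v → Alive F v → sumℚ (List.map (f v) (allV n)) ≡ 1ℚ
  perfect v v-alive = begin
    sumℚ (List.map (f v) (allV n))
      ≡⟨ sumℚ-+ (λ u → weight (sends v u)) (λ u → weight (sends u v)) (allV n) ⟩
    sumℚ (List.map (λ u → weight (sends v u)) (allV n)) +ℚ sumℚ (List.map (λ u → weight (sends u v)) (allV n))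
      ≡⟨ cong₂ _+ℚ_ (point (σ v) out) (point u₀ into) ⟩
    ½ +ℚ ½
      ≡⟨⟩
    1ℚ ∎
    where
    open ≡-Reasoning
    u₀ : V n
    u₀ = proj₁ (σ-surjective v-alive)
    u₀-alive : Alive F u₀
    u₀-alive = proj₁ (proj₂ (σ-surjective v-alive))
    σu₀≡v : σ u₀ ≡ v
    σu₀≡v = proj₂ (proj₂ (σ-surjective v-alive))

    point : ∀ w {s : V n → Bool} → (∀ u → s u ≡ does (u ≟ⱽ w)) → sumℚ (List.map (weight ∘ s) (allV n)) ≡ ½
    point w s≗δ = trans (cong sumℚ (map-cong (cong weight ∘ s≗δ) (allV n)))
                        (sumℚ-point w ½ (allV-unique n) (allV-complete w))

    out : ∀ u → sends v u ≡ does (u ≟ⱽ σ v)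
    out u = does-⇔ (mk⇔ (λ (_ , σv≡u) → sym σv≡u) (λ u≡σv → v-alive , sym u≡σv))
                    (alive? F v ×-dec σ v ≟ⱽ u) (u ≟ⱽ σ v)

    into : ∀ u → sends u v ≡ does (u ≟ⱽ u₀)
    into u = does-⇔ (mk⇔ (λ (u-alive , σu≡v) → σ-injective u-alive u₀-alive (trans σu≡v (sym σu₀≡v)))
                         (λ { refl → u₀-alive , σu₀≡v }))
                     (alive? F u ×-dec σ u ≟ⱽ v) (u ≟ⱽ u₀)

isolated⇒FSMP : ∀ {n F} → HasIsolatedVertex n F → IsFSMP n F
isolated⇒FSMP {n} (v , v-alive , no-edge) fpm = 0≢1 (begin
  0ℚ                             ≡⟨ sym (sumℚ-zero (f v) {allV n} (All.tabulate λ {u} _ → support v u (no-edge u))) ⟩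
  sumℚ (List.map (f v) (allV n)) ≡⟨ perfect v v-alive ⟩
  1ℚ                             ∎)
  where
  open FracPerfectMatching fpm
  open ≡-Reasoning
  0≢1 : 0ℚ ≢ 1ℚ
  0≢1 ()

neighbourhoodFault : ∀ n → V n → FaultSet n
neighbourhoodFault n v = record
  { vs = List.filter (λ u → adjB n v u ≟ᵇ true) (allV n)
  ; es = []
  ; vsUniq = Unique.filter⁺ _ (allV-unique n)
  ; esUniq = AllPairs.[]
  ; esEdges = λ ()
  }

neighbourhoodFault-isolates : ∀ n v → HasIsolatedVertex n (neighbourhoodFault n v)
neighbourhoodFault-isolates n v = v , v-alive , λ u (vu , _ , u-alive , _) →
  u-alive (∈-filter⁺ (λ u → adjB n v u ≟ᵇ true) (allV-complete u) (Equivalence.to T-≡ vu))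
  where
  v-alive : Alive (neighbourhoodFault n v) v
  v-alive v∈ =
    case trans (sym (adjB-irrefl n v)) (proj₂ (∈-filter⁻ (λ u → adjB n v u ≟ᵇ true) {xs = allV n} v∈)) of λ ()

x∈p─q⁻ : ∀ {n} (p q : Subset n) {x} → x ∈ₛ p ─ q → x ∈ₛ p × x ∉ₛ q
x∈p─q⁻ (inside ∷ p) (outside ∷ q) here = here , λ ()
x∈p─q⁻ (outside ∷ p) (inside ∷ q) {zero} ()
x∈p─q⁻ (outside ∷ p) (outside ∷ q) {zero} ()
x∈p─q⁻ (_ ∷ p) (_ ∷ q) (there x∈p─q) =
  there (proj₁ (x∈p─q⁻ p q x∈p─q)) , proj₂ (x∈p─q⁻ p q x∈p─q) ∘ drop-there

x∈p-y⁻ : ∀ {n} (p : Subset n) {x y} → x ∈ₛ p - y → x ∈ₛ p × x ≢ y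
x∈p-y⁻ p {y = y} x∈p-y = proj₁ (x∈p─q⁻ p ⁅ y ⁆ x∈p-y) , x∉⁅y⁆⇒x≢y (proj₂ (x∈p─q⁻ p ⁅ y ⁆ x∈p-y))

∣p∪q∣+∣p∩q∣≡∣p∣+∣q∣ : ∀ {n} (p q : Subset n) → ∣ p ∪ q ∣ + ∣ p ∩ q ∣ ≡ ∣ p ∣ + ∣ q ∣
∣p∪q∣+∣p∩q∣≡∣p∣+∣q∣ [] [] = refl
∣p∪q∣+∣p∩q∣≡∣p∣+∣q∣ (inside ∷ p) (inside ∷ q) =
  cong suc (trans (+-suc _ _) (trans (cong suc (∣p∪q∣+∣p∩q∣≡∣p∣+∣q∣ p q)) (sym (+-suc _ _))))
∣p∪q∣+∣p∩q∣≡∣p∣+∣q∣ (inside ∷ p) (outside ∷ q) = cong suc (∣p∪q∣+∣p∩q∣≡∣p∣+∣q∣ p q)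
∣p∪q∣+∣p∩q∣≡∣p∣+∣q∣ (outside ∷ p) (inside ∷ q) =
  trans (cong suc (∣p∪q∣+∣p∩q∣≡∣p∣+∣q∣ p q)) (sym (+-suc _ _))
∣p∪q∣+∣p∩q∣≡∣p∣+∣q∣ (outside ∷ p) (outside ∷ q) = ∣p∪q∣+∣p∩q∣≡∣p∣+∣q∣ p q

∣p∪q∣≤∣p∣+∣q∣ : ∀ {n} (p q : Subset n) → ∣ p ∪ q ∣ ≤ ∣ p ∣ + ∣ q ∣
∣p∪q∣≤∣p∣+∣q∣ p q = ≤-trans (m≤m+n _ _) (≤-reflexive (∣p∪q∣+∣p∩q∣≡∣p∣+∣q∣ p q))

empty⇒∣p∣≡0 : ∀ {n} {p : Subset n} → Empty p → ∣ p ∣ ≡ 0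
empty⇒∣p∣≡0 {n} empty = trans (cong ∣_∣ (Empty-unique empty)) (∣⊥∣≡0 n)

∣p∪q∣≡∣p∣+∣q∣ : ∀ {n} (p q : Subset n) → Empty (p ∩ q) → ∣ p ∪ q ∣ ≡ ∣ p ∣ + ∣ q ∣
∣p∪q∣≡∣p∣+∣q∣ p q disjoint = begin
  ∣ p ∪ q ∣             ≡⟨ sym (+-identityʳ _) ⟩
  ∣ p ∪ q ∣ + 0         ≡⟨ cong (∣ p ∪ q ∣ +_) (sym (empty⇒∣p∣≡0 disjoint)) ⟩
  ∣ p ∪ q ∣ + ∣ p ∩ q ∣ ≡⟨ ∣p∪q∣+∣p∩q∣≡∣p∣+∣q∣ p q ⟩
  ∣ p ∣ + ∣ q ∣         ∎
  where open ≡-Reasoning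

∣p─q∣+∣p∩q∣≡∣p∣ : ∀ {n} (p q : Subset n) → ∣ p ─ q ∣ + ∣ p ∩ q ∣ ≡ ∣ p ∣
∣p─q∣+∣p∩q∣≡∣p∣ [] [] = refl
∣p─q∣+∣p∩q∣≡∣p∣ (inside ∷ p) (inside ∷ q) = trans (+-suc _ _) (cong suc (∣p─q∣+∣p∩q∣≡∣p∣ p q))
∣p─q∣+∣p∩q∣≡∣p∣ (inside ∷ p) (outside ∷ q) = cong suc (∣p─q∣+∣p∩q∣≡∣p∣ p q)
∣p─q∣+∣p∩q∣≡∣p∣ (outside ∷ p) (inside ∷ q) = ∣p─q∣+∣p∩q∣≡∣p∣ p q
∣p─q∣+∣p∩q∣≡∣p∣ (outside ∷ p) (outside ∷ q) = ∣p─q∣+∣p∩q∣≡∣p∣ p q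

∣p∣≡1+∣p-x∣ : ∀ {n} {p : Subset n} {x} → x ∈ₛ p → ∣ p ∣ ≡ suc ∣ p - x ∣
∣p∣≡1+∣p-x∣ {p = inside ∷ p} here = cong (suc ∘ ∣_∣) (sym (p─⊥≡p p))
∣p∣≡1+∣p-x∣ {p = inside ∷ p} (there x∈p) = cong suc (∣p∣≡1+∣p-x∣ x∈p)
∣p∣≡1+∣p-x∣ {p = outside ∷ p} (there x∈p) = ∣p∣≡1+∣p-x∣ x∈p

x∈p⇒0<∣p∣ : ∀ {n} {p : Subset n} {x} → x ∈ₛ p → 0 < ∣ p ∣
x∈p⇒0<∣p∣ x∈p = subst (0 <_) (sym (∣p∣≡1+∣p-x∣ x∈p)) (s≤s z≤n)

injection⇒∣p∣≤∣q∣ : ∀ {m n} {p : Subset m} {q : Subset n} (σ : Fin m → Fin n) →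
                    (∀ {i} → i ∈ₛ p → σ i ∈ₛ q) →
                    (∀ {i j} → i ∈ₛ p → j ∈ₛ p → σ i ≡ σ j → i ≡ j) → ∣ p ∣ ≤ ∣ q ∣
injection⇒∣p∣≤∣q∣ {p = []} σ into inj = z≤n
injection⇒∣p∣≤∣q∣ {p = outside ∷ p} σ into inj =
  injection⇒∣p∣≤∣q∣ (σ ∘ suc) (into ∘ there) λ i∈p j∈p eq → suc-injective (inj (there i∈p) (there j∈p) eq)
injection⇒∣p∣≤∣q∣ {p = inside ∷ p} {q} σ into inj = begin
  suc ∣ p ∣         ≤⟨ s≤s (injection⇒∣p∣≤∣q∣ (σ ∘ suc) into′ inj′) ⟩
  suc ∣ q - σ zero ∣ ≡⟨ sym (∣p∣≡1+∣p-x∣ (into here)) ⟩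
  ∣ q ∣             ∎
  where
  open ≤-Reasoning
  into′ : ∀ {i} → i ∈ₛ p → σ (suc i) ∈ₛ q - σ zero
  into′ i∈p = x∈p∧x≢y⇒x∈p-y (into (there i∈p)) λ eq → 0≢1+n (inj here (there i∈p) (sym eq))
  inj′ : ∀ {i j} → i ∈ₛ p → j ∈ₛ p → σ (suc i) ≡ σ (suc j) → i ≡ j
  inj′ i∈p j∈p eq = suc-injective (inj (there i∈p) (there j∈p) eq)

cover⇒∣p∣≤length : ∀ {A : Set} {n} (R : Fin n → A → Set) → (∀ i a → Dec (R i a)) →
                   (xs : List A) (p : Subset n) →
                   (∀ {i} → i ∈ₛ p → ∃ λ a → a ∈ xs × R i a) →
                   (∀ {i j a} → i ∈ₛ p → j ∈ₛ p → R i a → R j a → i ≡ j) → ∣ p ∣ ≤ length xs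
cover⇒∣p∣≤length R R? [] p witness unique =
  ≤-reflexive (empty⇒∣p∣≡0 λ (i , i∈p) → case proj₁ (proj₂ (witness i∈p)) of λ ())
cover⇒∣p∣≤length R R? (a ∷ xs) p witness unique with any? (λ i → i ∈ₛ? p ×-dec R? i a)
... | no none = m≤n⇒m≤1+n (cover⇒∣p∣≤length R R? xs p witness′ unique)
  where
  witness′ : ∀ {i} → i ∈ₛ p → ∃ λ b → b ∈ xs × R i b
  witness′ i∈p with witness i∈p
  ... | b , Any.here refl , Rib = ⊥-elim (none (_ , i∈p , Rib))
  ... | b , Any.there b∈xs , Rib = b , b∈xs , Rib
... | yes (i₀ , i₀∈p , Ri₀a) = begin
  ∣ p ∣              ≡⟨ ∣p∣≡1+∣p-x∣ i₀∈p ⟩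
  suc ∣ p - i₀ ∣     ≤⟨ s≤s (cover⇒∣p∣≤length R R? xs (p - i₀) witness′ unique′) ⟩
  suc (length xs)   ∎
  where
  open ≤-Reasoning
  witness′ : ∀ {i} → i ∈ₛ p - i₀ → ∃ λ b → b ∈ xs × R i b
  witness′ i∈p-i₀ with x∈p-y⁻ p i∈p-i₀ | witness (proj₁ (x∈p-y⁻ p i∈p-i₀))
  ... | i∈p , i≢i₀ | b , Any.here refl , Rib = ⊥-elim (i≢i₀ (unique i∈p i₀∈p Rib Ri₀a))
  ... | _ | b , Any.there b∈xs , Rib = b , b∈xs , Rib
  unique′ : ∀ {i j b} → i ∈ₛ p - i₀ → j ∈ₛ p - i₀ → R i b → R j b → i ≡ j
  unique′ i∈ j∈ = unique (proj₁ (x∈p-y⁻ p i∈)) (proj₁ (x∈p-y⁻ p j∈))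

length-filter-disjoint : ∀ {A : Set} {P Q R : A → Set}
                         (P? : ∀ x → Dec (P x)) (Q? : ∀ x → Dec (Q x)) (R? : ∀ x → Dec (R x)) →
                         (∀ {x} → P x → Q x → ⊥) → (∀ {x} → P x → R x) → (∀ {x} → Q x → R x) →
                         ∀ xs → length (filter P? xs) + length (filter Q? xs) ≤ length (filter R? xs)
length-filter-disjoint P? Q? R? disjoint P⇒R Q⇒R [] = z≤n
length-filter-disjoint P? Q? R? disjoint P⇒R Q⇒R (x ∷ xs)
  with P? x | Q? x | R? x | length-filter-disjoint P? Q? R? disjoint P⇒R Q⇒R xs
... | yes p | yes q | _     | _  = ⊥-elim (disjoint p q)
... | yes p | no _  | no ¬r | _  = ⊥-elim (¬r (P⇒R p))
... | no _  | yes q | no ¬r | _  = ⊥-elim (¬r (Q⇒R q))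
... | yes _ | no _  | yes _ | ih = s≤s ih
... | no _  | yes _ | yes _ | ih = ≤-trans (≤-reflexive (+-suc _ _)) (s≤s ih)
... | no _  | no _  | yes _ | ih = m≤n⇒m≤1+n ih
... | no _  | no _  | no _  | ih = ih

length-filter-partition : ∀ {A : Set} {P Q : A → Set} (P? : ∀ x → Dec (P x)) (Q? : ∀ x → Dec (Q x)) →
                          (∀ {x} → P x → Q x → ⊥) → ∀ xs → length (filter P? xs) + length (filter Q? xs) ≤ length xs
length-filter-partition P? Q? disjoint xs = ≤-trans
  (length-filter-disjoint P? Q? (λ _ → yes tt) disjoint _ _ xs)
  (≤-reflexive (cong length (filter-all (λ _ → yes tt) {xs} (All.tabulate λ _ → tt))))

⟦_⟧ : ∀ {n} {P : Fin n → Set} → (∀ i → Dec (P i)) → Subset n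
⟦ P? ⟧ = tabulate (does ∘ P?)

∈⟦⟧⁺ : ∀ {n} {P : Fin n → Set} (P? : ∀ i → Dec (P i)) {i} → P i → i ∈ₛ ⟦ P? ⟧
∈⟦⟧⁺ P? {i} Pi = lookup⇒[]= i ⟦ P? ⟧ (trans (lookup∘tabulate (does ∘ P?) i) (dec-true (P? i) Pi))

∈⟦⟧⁻ : ∀ {n} {P : Fin n → Set} (P? : ∀ i → Dec (P i)) {i} → i ∈ₛ ⟦ P? ⟧ → P i
∈⟦⟧⁻ P? {i} i∈ with P? i | trans (sym (lookup∘tabulate (does ∘ P?) i)) ([]=⇒lookup i∈)
... | yes Pi | _ = Pi
... | no _ | ()

record Profile (n : ℕ) : Set where
  constructor profile
  field
    members    : Subset n
    neighbours : Subset n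
    innerEdges : ℕ
open Profile

emptyProfile : ∀ {n} → Profile n
emptyProfile = profile ∅ ∅ 0

-- r is the neighbourhood of v; each inner edge is counted when the later of its endpoints is added.
addVertex : ∀ {n} → Subset n → Fin n → Profile n → Profile n
addVertex r v (profile I N e) = profile (⁅ v ⁆ ∪ I) (r ∪ N) (∣ r ∩ I ∣ + e)

profileOf : ∀ {m n} → (Fin n → Subset n) → Vec (Fin n) m → Subset m → Profile n
profileOf adj [] [] = emptyProfile
profileOf adj (v ∷ vs) (inside ∷ X) = addVertex (adj v) v (profileOf adj vs X)
profileOf adj (v ∷ vs) (outside ∷ X) = profileOf adj vs X

-- Binding adj v in extend shares it between all the subsets below, which keeps the exhaustive check fast.
every : ∀ {m n} → (Fin n → Subset n) → Vec (Fin n) m → (Subset m → Profile n → Bool) → Bool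
every adj [] P = P [] emptyProfile
every {n = n} adj (v ∷ vs) P = extend (adj v)
  where
  extend : Subset n → Bool
  extend r = every adj vs λ X s → P (inside ∷ X) (addVertex r v s) ∧ P (outside ∷ X) s

every-sound : ∀ {m n} adj (vs : Vec (Fin n) m) P → every adj vs P ≡ true → ∀ X → P X (profileOf adj vs X) ≡ true
every-sound adj [] P ok [] = ok
every-sound adj (v ∷ vs) P ok (inside ∷ X) = ∧-conicalˡ _ _ (every-sound adj vs _ ok X)
every-sound adj (v ∷ vs) P ok (outside ∷ X) = ∧-conicalʳ _ _ (every-sound adj vs _ ok X)

module _ {n : ℕ} (adj : Fin n → Subset n) where

  ∈-members⁻ : ∀ {m} (vs : Vec (Fin n) m) X {j} → j ∈ₛ members (profileOf adj vs X) →
               ∃ λ k → k ∈ₛ X × lookup vs k ≡ j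
  ∈-members⁻ [] [] j∈ = ⊥-elim (∉⊥ j∈)
  ∈-members⁻ (v ∷ vs) (inside ∷ X) j∈ with x∈p∪q⁻ ⁅ v ⁆ _ j∈
  ... | inj₁ j∈⁅v⁆ = zero , here , sym (x∈⁅y⁆⇒x≡y v j∈⁅v⁆)
  ... | inj₂ j∈′ = let k , k∈X , eq = ∈-members⁻ vs X j∈′ in suc k , there k∈X , eq
  ∈-members⁻ (v ∷ vs) (outside ∷ X) j∈ = let k , k∈X , eq = ∈-members⁻ vs X j∈ in suc k , there k∈X , eq

  ∈-members⁺ : ∀ {m} (vs : Vec (Fin n) m) X {k} → k ∈ₛ X → lookup vs k ∈ₛ members (profileOf adj vs X)
  ∈-members⁺ (v ∷ vs) (inside ∷ X) here = x∈p∪q⁺ (inj₁ (x∈⁅x⁆ v))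
  ∈-members⁺ (v ∷ vs) (inside ∷ X) (there k∈X) = x∈p∪q⁺ (inj₂ (∈-members⁺ vs X k∈X))
  ∈-members⁺ (v ∷ vs) (outside ∷ X) (there k∈X) = ∈-members⁺ vs X k∈X

  ∈-neighbours⁻ : ∀ {m} (vs : Vec (Fin n) m) X {j} → j ∈ₛ neighbours (profileOf adj vs X) →
                  ∃ λ k → k ∈ₛ X × j ∈ₛ adj (lookup vs k)
  ∈-neighbours⁻ [] [] j∈ = ⊥-elim (∉⊥ j∈)
  ∈-neighbours⁻ (v ∷ vs) (inside ∷ X) j∈ with x∈p∪q⁻ (adj v) _ j∈
  ... | inj₁ j∈adj = zero , here , j∈adj
  ... | inj₂ j∈′ = let k , k∈X , j∈adj = ∈-neighbours⁻ vs X j∈′ in suc k , there k∈X , j∈adj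
  ∈-neighbours⁻ (v ∷ vs) (outside ∷ X) j∈ =
    let k , k∈X , j∈adj = ∈-neighbours⁻ vs X j∈ in suc k , there k∈X , j∈adj

  ∈-neighbours⁺ : ∀ {m} (vs : Vec (Fin n) m) X {k j} → k ∈ₛ X → j ∈ₛ adj (lookup vs k) →
                  j ∈ₛ neighbours (profileOf adj vs X)
  ∈-neighbours⁺ (v ∷ vs) (inside ∷ X) here j∈adj = x∈p∪q⁺ (inj₁ j∈adj)
  ∈-neighbours⁺ (v ∷ vs) (inside ∷ X) (there k∈X) j∈adj = x∈p∪q⁺ (inj₂ (∈-neighbours⁺ vs X k∈X j∈adj))
  ∈-neighbours⁺ (v ∷ vs) (outside ∷ X) (there k∈X) j∈adj = ∈-neighbours⁺ vs X k∈X j∈adj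

Inside : ∀ {n} → Subset n → Fin n × Fin n → Set
Inside M (a , b) = a ∈ₛ M × b ∈ₛ M

inside? : ∀ {n} (M : Subset n) e → Dec (Inside M e)
inside? M (a , b) = a ∈ₛ? M ×-dec b ∈ₛ? M

module _ {n : ℕ} (adj : Fin n → Subset n) (ys : List (Fin n × Fin n)) where

  ListsEdgesIn : Subset n → Set
  ListsEdgesIn M = ∀ {i j} → i ∈ₛ M → j ∈ₛ M → j ∈ₛ adj i → (i , j) ∈ ys ⊎ (j , i) ∈ ys

  Touches : Fin n → Subset n → Fin n × Fin n → Set
  Touches v M (a , b) = (a ≡ v × b ∈ₛ M) ⊎ (b ≡ v × a ∈ₛ M)

  touches? : ∀ v M e → Dec (Touches v M e)
  touches? v M (a , b) = (a ≟ᶠ v ×-dec b ∈ₛ? M) ⊎-dec (b ≟ᶠ v ×-dec a ∈ₛ? M)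

  module _ {v : Fin n} {M : Subset n} (v∉M : v ∉ₛ M) where

    touches∩inside : ∀ {e} → Touches v M e → Inside M e → ⊥
    touches∩inside (inj₁ (refl , _)) (a∈M , _) = v∉M a∈M
    touches∩inside (inj₂ (refl , _)) (_ , b∈M) = v∉M b∈M

    touches⇒inside : ∀ {e} → Touches v M e → Inside (⁅ v ⁆ ∪ M) e
    touches⇒inside (inj₁ (refl , b∈M)) = x∈p∪q⁺ (inj₁ (x∈⁅x⁆ v)) , x∈p∪q⁺ (inj₂ b∈M)
    touches⇒inside (inj₂ (refl , a∈M)) = x∈p∪q⁺ (inj₂ a∈M) , x∈p∪q⁺ (inj₁ (x∈⁅x⁆ v))

    -- each j ∈ adj v ∩ M is witnessed by the listed edge vj
    ∣adj∩M∣≤touches : ListsEdgesIn (⁅ v ⁆ ∪ M) → ∣ adj v ∩ M ∣ ≤ length (filter (touches? v M) ys)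
    ∣adj∩M∣≤touches listed = cover⇒∣p∣≤length Joins joins? (filter (touches? v M) ys) (adj v ∩ M) witness unique
      where
      Joins : Fin n → Fin n × Fin n → Set
      Joins j (a , b) = (a ≡ v × b ≡ j) ⊎ (b ≡ v × a ≡ j)
      joins? : ∀ j e → Dec (Joins j e)
      joins? j (a , b) = (a ≟ᶠ v ×-dec b ≟ᶠ j) ⊎-dec (b ≟ᶠ v ×-dec a ≟ᶠ j)

      witness : ∀ {j} → j ∈ₛ adj v ∩ M → ∃ λ e → e ∈ filter (touches? v M) ys × Joins j e
      witness {j} j∈ with x∈p∩q⁻ (adj v) M j∈
      ... | j∈adj , j∈M with listed (x∈p∪q⁺ (inj₁ (x∈⁅x⁆ v))) (x∈p∪q⁺ (inj₂ j∈M)) j∈adj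
      ... | inj₁ vj∈ys = (v , j) , ∈-filter⁺ (touches? v M) vj∈ys (inj₁ (refl , j∈M)) , inj₁ (refl , refl)
      ... | inj₂ jv∈ys = (j , v) , ∈-filter⁺ (touches? v M) jv∈ys (inj₂ (refl , j∈M)) , inj₂ (refl , refl)

      unique : ∀ {j j′ e} → j ∈ₛ adj v ∩ M → j′ ∈ₛ adj v ∩ M → Joins j e → Joins j′ e → j ≡ j′
      unique _ _ (inj₁ (_ , refl)) (inj₁ (_ , refl)) = refl
      unique _ _ (inj₂ (_ , refl)) (inj₂ (_ , refl)) = refl
      unique j∈ _ (inj₁ (_ , refl)) (inj₂ (refl , _)) = ⊥-elim (v∉M (proj₂ (x∈p∩q⁻ (adj v) M j∈)))
      unique j∈ _ (inj₂ (_ , refl)) (inj₁ (refl , _)) = ⊥-elim (v∉M (proj₂ (x∈p∩q⁻ (adj v) M j∈)))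

  innerEdges≤ : ∀ {m} (vs : Vec (Fin n) m) X → (∀ {k l} → lookup vs k ≡ lookup vs l → k ≡ l) →
                let P = profileOf adj vs X in
                ListsEdgesIn (members P) → innerEdges P ≤ length (filter (inside? (members P)) ys)
  innerEdges≤ [] [] _ _ = z≤n
  innerEdges≤ (v ∷ vs) (outside ∷ X) injective listed = innerEdges≤ vs X (suc-injective ∘ injective) listed
  innerEdges≤ (v ∷ vs) (inside ∷ X) injective listed = begin
    ∣ adj v ∩ M ∣ + innerEdges (profileOf adj vs X)
      ≤⟨ +-mono-≤ (∣adj∩M∣≤touches v∉M listed)
                  (innerEdges≤ vs X (suc-injective ∘ injective) λ i∈ j∈ → listed (old i∈) (old j∈)) ⟩
    length (filter (touches? v M) ys) + length (filter (inside? M) ys)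
      ≤⟨ length-filter-disjoint (touches? v M) (inside? M) (inside? (⁅ v ⁆ ∪ M))
           (touches∩inside v∉M) (touches⇒inside v∉M) (λ (a∈M , b∈M) → old a∈M , old b∈M) ys ⟩
    length (filter (inside? (⁅ v ⁆ ∪ M)) ys) ∎
    where
    open ≤-Reasoning
    M : Subset n
    M = members (profileOf adj vs X)
    old : ∀ {j} → j ∈ₛ M → j ∈ₛ ⁅ v ⁆ ∪ M
    old j∈M = x∈p∪q⁺ (inj₂ j∈M)
    v∉M : v ∉ₛ M
    v∉M v∈M = let k , _ , vₖ≡v = ∈-members⁻ adj vs X v∈M in 0≢1+n (injective (sym vₖ≡v))

module _ {n : ℕ} (adj : Fin n → Subset n) where

  neighbourhood : Subset n → Subset n
  neighbourhood X = neighbours (profileOf adj (allFin n) X)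

  innerEdgeCount : Subset n → ℕ
  innerEdgeCount X = innerEdges (profileOf adj (allFin n) X)

  ∈-neighbourhood⁺ : ∀ {X i j} → i ∈ₛ X → j ∈ₛ adj i → j ∈ₛ neighbourhood X
  ∈-neighbourhood⁺ {X} {i} i∈X j∈adj =
    ∈-neighbours⁺ adj (allFin n) X i∈X (subst (λ k → _ ∈ₛ adj k) (sym (lookup-allFin i)) j∈adj)

  ∈-neighbourhood⁻ : ∀ {X j} → j ∈ₛ neighbourhood X → ∃ λ i → i ∈ₛ X × j ∈ₛ adj i
  ∈-neighbourhood⁻ {X} j∈ = let i , i∈X , j∈adj = ∈-neighbours⁻ adj (allFin n) X j∈ in
    i , i∈X , subst (λ k → _ ∈ₛ adj k) (lookup-allFin i) j∈adj

  allFin-injective : ∀ {k l} → lookup (allFin n) k ≡ lookup (allFin n) l → k ≡ l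
  allFin-injective {k} {l} eq = trans (sym (lookup-allFin k)) (trans eq (lookup-allFin l))

  members-allFin : ∀ X → members (profileOf adj (allFin n) X) ≡ X
  members-allFin X = ⊆-antisym
    (λ j∈ → let k , k∈X , eq = ∈-members⁻ adj (allFin n) X j∈ in subst (_∈ₛ X) (trans (sym (lookup-allFin k)) eq) k∈X)
    (λ {k} k∈X → subst (_∈ₛ members (profileOf adj (allFin n) X)) (lookup-allFin k) (∈-members⁺ adj (allFin n) X k∈X))

  innerEdgeCount≤ : ∀ ys X → ListsEdgesIn adj ys X → innerEdgeCount X ≤ length (filter (inside? X) ys)
  innerEdgeCount≤ ys X listed =
    subst (λ M → innerEdgeCount X ≤ length (filter (inside? M) ys)) (members-allFin X)
      (innerEdges≤ adj ys (allFin n) X allFin-injective (subst (ListsEdgesIn adj ys) (sym (members-allFin X)) listed))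

0<∣p∣⇒nonempty : ∀ {n} (p : Subset n) → 0 < ∣ p ∣ → Nonempty p
0<∣p∣⇒nonempty p 0<∣p∣ with nonempty? p
... | yes ne = ne
... | no empty = ⊥-elim (<-irrefl (sym (empty⇒∣p∣≡0 empty)) 0<∣p∣)

-- Hall's theorem

module Hall {n : ℕ} (adj : Fin n → Subset n) where

  N : Subset n → Subset n
  N = neighbourhood adj

  record Matching (L T : Subset n) : Set where
    field
      σ           : Fin n → Fin n
      σ∈T         : ∀ {i} → i ∈ₛ L → σ i ∈ₛ T
      σ∈adj       : ∀ {i} → i ∈ₛ L → σ i ∈ₛ adj i
      σ-injective : ∀ {i j} → i ∈ₛ L → j ∈ₛ L → σ i ≡ σ j → i ≡ j
  open Matching

  HallCondition : Subset n → Subset n → Set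
  HallCondition L T = ∀ X → X ⊆ L → ∣ X ∣ ≤ ∣ N X ∩ T ∣

  emptyMatching : ∀ {L T} → Empty L → Matching L T
  emptyMatching empty = record
    { σ = λ i → i
    ; σ∈T = λ i∈L → ⊥-elim (empty (_ , i∈L))
    ; σ∈adj = λ i∈L → ⊥-elim (empty (_ , i∈L))
    ; σ-injective = λ i∈L _ _ → ⊥-elim (empty (_ , i∈L))
    }

  singletonMatching : ∀ {x y} → y ∈ₛ adj x → Matching ⁅ x ⁆ ⁅ y ⁆
  singletonMatching {x} {y} y∈adj = record
    { σ = λ _ → y
    ; σ∈T = λ _ → x∈⁅x⁆ y
    ; σ∈adj = λ i∈ → subst (λ i → y ∈ₛ adj i) (sym (x∈⁅y⁆⇒x≡y x i∈)) y∈adj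
    ; σ-injective = λ i∈ j∈ _ → trans (x∈⁅y⁆⇒x≡y x i∈) (sym (x∈⁅y⁆⇒x≡y x j∈))
    }

  matching-mono : ∀ {L L′ T T′} → Matching L T → L′ ⊆ L → T ⊆ T′ → Matching L′ T′
  matching-mono m L′⊆L T⊆T′ = record
    { σ = σ m
    ; σ∈T = T⊆T′ ∘ σ∈T m ∘ L′⊆L
    ; σ∈adj = σ∈adj m ∘ L′⊆L
    ; σ-injective = λ i∈ j∈ → σ-injective m (L′⊆L i∈) (L′⊆L j∈)
    }

  matching-∩N : ∀ {L T} → Matching L T → Matching L (N L ∩ T)
  matching-∩N m = record
    { σ = σ m
    ; σ∈T = λ i∈L → x∈p∩q⁺ (∈-neighbourhood⁺ adj i∈L (σ∈adj m i∈L) , σ∈T m i∈L)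
    ; σ∈adj = σ∈adj m
    ; σ-injective = σ-injective m
    }

  matching-∪ : ∀ {A B T₁ T₂} → Matching A T₁ → Matching B T₂ → (∀ {j} → j ∈ₛ T₁ → j ∉ₛ T₂) →
               Matching (A ∪ B) (T₁ ∪ T₂)
  matching-∪ {A} {B} {T₁} {T₂} m₁ m₂ disjoint = record
    { σ = σ′ ; σ∈T = σ′∈T ; σ∈adj = σ′∈adj ; σ-injective = σ′-injective }
    where
    σ′ : Fin n → Fin n
    σ′ i with i ∈ₛ? A
    ... | yes _ = σ m₁ i
    ... | no _ = σ m₂ i

    inB : ∀ {i} → i ∈ₛ A ∪ B → i ∉ₛ A → i ∈ₛ B
    inB {i} i∈ i∉A with x∈p∪q⁻ A B i∈
    ... | inj₁ i∈A = ⊥-elim (i∉A i∈A)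
    ... | inj₂ i∈B = i∈B

    σ′∈T : ∀ {i} → i ∈ₛ A ∪ B → σ′ i ∈ₛ T₁ ∪ T₂
    σ′∈T {i} i∈ with i ∈ₛ? A
    ... | yes i∈A = x∈p∪q⁺ (inj₁ (σ∈T m₁ i∈A))
    ... | no i∉A = x∈p∪q⁺ (inj₂ (σ∈T m₂ (inB i∈ i∉A)))

    σ′∈adj : ∀ {i} → i ∈ₛ A ∪ B → σ′ i ∈ₛ adj i
    σ′∈adj {i} i∈ with i ∈ₛ? A
    ... | yes i∈A = σ∈adj m₁ i∈A
    ... | no i∉A = σ∈adj m₂ (inB i∈ i∉A)

    σ′-injective : ∀ {i j} → i ∈ₛ A ∪ B → j ∈ₛ A ∪ B → σ′ i ≡ σ′ j → i ≡ j
    σ′-injective {i} {j} i∈ j∈ eq with i ∈ₛ? A | j ∈ₛ? A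
    ... | yes i∈A | yes j∈A = σ-injective m₁ i∈A j∈A eq
    ... | no i∉A  | no j∉A  = σ-injective m₂ (inB i∈ i∉A) (inB j∈ j∉A) eq
    ... | yes i∈A | no j∉A  = ⊥-elim (disjoint (σ∈T m₁ i∈A) (subst (_∈ₛ T₂) (sym eq) (σ∈T m₂ (inB j∈ j∉A))))
    ... | no i∉A  | yes j∈A = ⊥-elim (disjoint (σ∈T m₁ j∈A) (subst (_∈ₛ T₂) eq (σ∈T m₂ (inB i∈ i∉A))))

  Tight : Subset n → Subset n → Subset n → Set
  Tight L T X = Nonempty X × X ⊆ L × ∣ X ∣ < ∣ L ∣ × ∣ N X ∩ T ∣ ≤ ∣ X ∣

  tight? : ∀ L T X → Dec (Tight L T X)
  tight? L T X = nonempty? X ×-dec X ⊆? L ×-dec ∣ X ∣ <? ∣ L ∣ ×-dec ∣ N X ∩ T ∣ ≤? ∣ X ∣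

  hallCondition-─tight : ∀ {L T X} → HallCondition L T → X ⊆ L → ∣ N X ∩ T ∣ ≤ ∣ X ∣ →
                         HallCondition (L ─ X) (T ─ N X)
  hallCondition-─tight {L} {T} {X} condition X⊆L ∣NX∩T∣≤∣X∣ Z Z⊆L─X =
    +-cancelʳ-≤ (∣ X ∣) (∣ Z ∣) (∣ N Z ∩ (T ─ N X) ∣) (begin
    ∣ Z ∣ + ∣ X ∣                                    ≡⟨ sym (∣p∪q∣≡∣p∣+∣q∣ Z X Z∩X-empty) ⟩
    ∣ Z ∪ X ∣                                        ≤⟨ condition (Z ∪ X) Z∪X⊆L ⟩
    ∣ N (Z ∪ X) ∩ T ∣                                ≤⟨ p⊆q⇒∣p∣≤∣q∣ split ⟩
    ∣ (N Z ∩ (T ─ N X)) ∪ (N X ∩ T) ∣                ≤⟨ ∣p∪q∣≤∣p∣+∣q∣ (N Z ∩ (T ─ N X)) (N X ∩ T) ⟩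
    ∣ N Z ∩ (T ─ N X) ∣ + ∣ N X ∩ T ∣                ≤⟨ +-monoʳ-≤ _ ∣NX∩T∣≤∣X∣ ⟩
    ∣ N Z ∩ (T ─ N X) ∣ + ∣ X ∣                      ∎)
    where
    open ≤-Reasoning
    Z∩X-empty : Empty (Z ∩ X)
    Z∩X-empty (i , i∈Z∩X) = proj₂ (x∈p─q⁻ L X (Z⊆L─X (proj₁ (x∈p∩q⁻ Z X i∈Z∩X)))) (proj₂ (x∈p∩q⁻ Z X i∈Z∩X))
    Z∪X⊆L : Z ∪ X ⊆ L
    Z∪X⊆L i∈ with x∈p∪q⁻ Z X i∈
    ... | inj₁ i∈Z = p─q⊆p L X (Z⊆L─X i∈Z)
    ... | inj₂ i∈X = X⊆L i∈X
    split : N (Z ∪ X) ∩ T ⊆ (N Z ∩ (T ─ N X)) ∪ (N X ∩ T)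
    split {j} j∈ with x∈p∩q⁻ (N (Z ∪ X)) T j∈ | j ∈ₛ? N X
    ... | _ , j∈T | yes j∈NX = x∈p∪q⁺ (inj₂ (x∈p∩q⁺ (j∈NX , j∈T)))
    ... | j∈N , j∈T | no j∉NX with ∈-neighbourhood⁻ adj j∈N
    ... | i , i∈Z∪X , j∈adj with x∈p∪q⁻ Z X i∈Z∪X
    ... | inj₁ i∈Z = x∈p∪q⁺ (inj₁ (x∈p∩q⁺ (∈-neighbourhood⁺ adj i∈Z j∈adj , x∈p∧x∉q⇒x∈p─q j∈T j∉NX)))
    ... | inj₂ i∈X = ⊥-elim (j∉NX (∈-neighbourhood⁺ adj i∈X j∈adj))

  -- Without tight sets every nonempty Z ⊆ L - x has more than |Z| neighbours in T, so losing any y is affordable.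
  hallCondition-slack : ∀ {L T x} → (∀ X → ¬ Tight L T X) → x ∈ₛ L → ∀ y → HallCondition (L - x) (T - y)
  hallCondition-slack {L} {T} {x} noneTight x∈L y Z Z⊆L-x with nonempty? Z
  ... | no empty = ≤-trans (≤-reflexive (empty⇒∣p∣≡0 empty)) z≤n
  ... | yes Z-nonempty = ≤-pred (begin-strict
    ∣ Z ∣                        <⟨ ≰⇒> (λ le → noneTight Z (Z-nonempty , Z⊆L , ∣Z∣<∣L∣ , le)) ⟩
    ∣ N Z ∩ T ∣                  ≤⟨ p⊆q⇒∣p∣≤∣q∣ split ⟩
    ∣ (N Z ∩ (T - y)) ∪ ⁅ y ⁆ ∣  ≤⟨ ∣p∪q∣≤∣p∣+∣q∣ (N Z ∩ (T - y)) ⁅ y ⁆ ⟩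
    ∣ N Z ∩ (T - y) ∣ + ∣ ⁅ y ⁆ ∣ ≡⟨ cong (∣ N Z ∩ (T - y) ∣ +_) (∣⁅x⁆∣≡1 y) ⟩
    ∣ N Z ∩ (T - y) ∣ + 1         ≡⟨ +-comm _ 1 ⟩
    suc ∣ N Z ∩ (T - y) ∣         ∎)
    where
    open ≤-Reasoning
    Z⊆L : Z ⊆ L
    Z⊆L = proj₁ ∘ x∈p-y⁻ L ∘ Z⊆L-x
    ∣Z∣<∣L∣ : ∣ Z ∣ < ∣ L ∣
    ∣Z∣<∣L∣ = ≤-<-trans (p⊆q⇒∣p∣≤∣q∣ Z⊆L-x) (x∈p⇒∣p-x∣<∣p∣ x∈L)
    split : N Z ∩ T ⊆ (N Z ∩ (T - y)) ∪ ⁅ y ⁆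
    split {j} j∈ with j ≟ᶠ y | x∈p∩q⁻ (N Z) T j∈
    ... | yes refl | _ = x∈p∪q⁺ (inj₂ (x∈⁅x⁆ y))
    ... | no j≢y | j∈NZ , j∈T = x∈p∪q⁺ (inj₁ (x∈p∩q⁺ (j∈NZ , x∈p∧x≢y⇒x∈p-y j∈T j≢y)))

  MatchesUpTo : ℕ → Set
  MatchesUpTo k = ∀ L T → ∣ L ∣ ≤ k → HallCondition L T → Matching L T

  matchThroughTight : ∀ {k L T X} → MatchesUpTo k → ∣ L ∣ ≤ suc k → HallCondition L T → Tight L T X →
                      Matching L T
  matchThroughTight {k} {L} {T} {X} hall ∣L∣≤1+k condition ((x , x∈X) , X⊆L , ∣X∣<∣L∣ , ∣NX∩T∣≤∣X∣) =
    matching-mono (matching-∪ (matching-∩N inX) rest separated) L⊆X∪L─X image⊆T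
    where
    inX : Matching X T
    inX = hall X T (≤-pred (≤-trans ∣X∣<∣L∣ ∣L∣≤1+k)) λ Z Z⊆X → condition Z (⊆-trans Z⊆X X⊆L)

    rest : Matching (L ─ X) (T ─ N X)
    rest = hall (L ─ X) (T ─ N X)
      (≤-pred (≤-trans (p∩q≢∅⇒∣p─q∣<∣p∣ L X (x , x∈p∩q⁺ (X⊆L x∈X , x∈X))) ∣L∣≤1+k))
      (hallCondition-─tight condition X⊆L ∣NX∩T∣≤∣X∣)

    separated : ∀ {j} → j ∈ₛ N X ∩ T → j ∉ₛ T ─ N X
    separated j∈ j∈T─NX = proj₂ (x∈p─q⁻ T (N X) j∈T─NX) (proj₁ (x∈p∩q⁻ (N X) T j∈))

    L⊆X∪L─X : L ⊆ X ∪ (L ─ X)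
    L⊆X∪L─X {i} i∈L with i ∈ₛ? X
    ... | yes i∈X = x∈p∪q⁺ (inj₁ i∈X)
    ... | no i∉X = x∈p∪q⁺ (inj₂ (x∈p∧x∉q⇒x∈p─q i∈L i∉X))

    image⊆T : (N X ∩ T) ∪ (T ─ N X) ⊆ T
    image⊆T j∈ with x∈p∪q⁻ (N X ∩ T) (T ─ N X) j∈
    ... | inj₁ j∈NX∩T = proj₂ (x∈p∩q⁻ (N X) T j∈NX∩T)
    ... | inj₂ j∈T─NX = p─q⊆p T (N X) j∈T─NX

  matchOneVertex : ∀ {k L T x} → MatchesUpTo k → ∣ L ∣ ≤ suc k → HallCondition L T →
                   (∀ X → ¬ Tight L T X) → x ∈ₛ L → Matching L T
  matchOneVertex {k} {L} {T} {x} hall ∣L∣≤1+k condition noneTight x∈L =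
    matching-mono (matching-∪ (singletonMatching y∈adj) rest separated) L⊆x∪L-x image⊆T
    where
    y-exists : Nonempty (N ⁅ x ⁆ ∩ T)
    y-exists = 0<∣p∣⇒nonempty _ (subst (_≤ ∣ N ⁅ x ⁆ ∩ T ∣) (∣⁅x⁆∣≡1 x)
                 (condition ⁅ x ⁆ λ i∈ → subst (_∈ₛ L) (sym (x∈⁅y⁆⇒x≡y x i∈)) x∈L))
    y : Fin n
    y = proj₁ y-exists
    y∈T : y ∈ₛ T
    y∈T = proj₂ (x∈p∩q⁻ (N ⁅ x ⁆) T (proj₂ y-exists))
    y∈adj : y ∈ₛ adj x
    y∈adj with ∈-neighbourhood⁻ adj (proj₁ (x∈p∩q⁻ (N ⁅ x ⁆) T (proj₂ y-exists)))
    ... | i , i∈⁅x⁆ , y∈adjᵢ = subst (λ i → y ∈ₛ adj i) (x∈⁅y⁆⇒x≡y x i∈⁅x⁆) y∈adjᵢ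

    rest : Matching (L - x) (T - y)
    rest = hall (L - x) (T - y) (≤-pred (≤-trans (x∈p⇒∣p-x∣<∣p∣ x∈L) ∣L∣≤1+k))
      (hallCondition-slack noneTight x∈L y)

    separated : ∀ {j} → j ∈ₛ ⁅ y ⁆ → j ∉ₛ T - y
    separated j∈⁅y⁆ j∈T-y = proj₂ (x∈p-y⁻ T j∈T-y) (x∈⁅y⁆⇒x≡y y j∈⁅y⁆)

    L⊆x∪L-x : L ⊆ ⁅ x ⁆ ∪ (L - x)
    L⊆x∪L-x {i} i∈L with i ≟ᶠ x
    ... | yes refl = x∈p∪q⁺ (inj₁ (x∈⁅x⁆ x))
    ... | no i≢x = x∈p∪q⁺ (inj₂ (x∈p∧x≢y⇒x∈p-y i∈L i≢x))

    image⊆T : ⁅ y ⁆ ∪ (T - y) ⊆ T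
    image⊆T j∈ with x∈p∪q⁻ ⁅ y ⁆ (T - y) j∈
    ... | inj₁ j∈⁅y⁆ = subst (_∈ₛ T) (sym (x∈⁅y⁆⇒x≡y y j∈⁅y⁆)) y∈T
    ... | inj₂ j∈T-y = proj₁ (x∈p-y⁻ T j∈T-y)

  hall : ∀ k → MatchesUpTo k
  hall zero L T ∣L∣≤0 _ = emptyMatching λ (_ , i∈L) → <-irrefl refl (≤-trans (x∈p⇒0<∣p∣ i∈L) ∣L∣≤0)
  hall (suc k) L T ∣L∣≤1+k condition with anySubset? (tight? L T) | nonempty? L
  ... | yes (X , tight) | _ = matchThroughTight (hall k) ∣L∣≤1+k condition tight
  ... | no noneTight | yes (x , x∈L) =
    matchOneVertex (hall k) ∣L∣≤1+k condition (λ X tight → noneTight (X , tight)) x∈L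
  ... | no _ | no empty = emptyMatching empty

  hall′ : ∀ L T → HallCondition L T → Matching L T
  hall′ L T = hall n L T (∣p∣≤n L)

adjacency : ∀ n → Fin (2 ^ n) → Subset (2 ^ n)
adjacency n i = ⟦ (λ j → T? (adjB n (vertex i) (vertex j))) ⟧

module _ {n : ℕ} (F : FaultSet n) where

  aliveSet : Subset (2 ^ n)
  aliveSet = ⟦ alive? F ∘ vertex ⟧

  survivingEdges : Fin (2 ^ n) → Subset (2 ^ n)
  survivingEdges i = ⟦ edgeIn? F (vertex i) ∘ vertex ⟧

  open Hall survivingEdges

  ∈aliveSet : ∀ v → Alive F v → index v ∈ₛ aliveSet
  ∈aliveSet v v-alive = ∈⟦⟧⁺ (alive? F ∘ vertex) (subst (Alive F) (sym (vertex-index v)) v-alive)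

  matching⇒EdgePermutation : Matching aliveSet aliveSet → EdgePermutation n F
  matching⇒EdgePermutation m = record
    { σ = σV ; σ-edge = σV-edge ; σ-injective = σV-injective ; σ-surjective = σV-surjective }
    where
    open Matching m
    σV : V n → V n
    σV v = vertex (σ (index v))

    σV-edge : ∀ {v} → Alive F v → EdgeIn n F v (σV v)
    σV-edge {v} v-alive =
      subst (λ u → EdgeIn n F u (σV v)) (vertex-index v)
        (∈⟦⟧⁻ (edgeIn? F (vertex (index v)) ∘ vertex) (σ∈adj (∈aliveSet v v-alive)))

    σV-injective : ∀ {u v} → Alive F u → Alive F v → σV u ≡ σV v → u ≡ v
    σV-injective {u} {v} u-alive v-alive eq =
      trans (sym (vertex-index u)) (trans (cong vertex (σ-injective (∈aliveSet u u-alive) (∈aliveSet v v-alive)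
        (vertex-injective {n} eq))) (vertex-index v))

    -- σ maps the alive set injectively into itself, so it misses no vertex
    σV-surjective : ∀ {v} → Alive F v → ∃ λ u → Alive F u × σV u ≡ v
    σV-surjective {v} v-alive with any? (λ i → i ∈ₛ? aliveSet ×-dec σ i ≟ᶠ index v)
    ... | yes (i , i∈L , σi≡v) =
      vertex i , ∈⟦⟧⁻ (alive? F ∘ vertex) i∈L ,
      trans (cong (vertex ∘ σ) (index-vertex {n} i)) (trans (cong vertex σi≡v) (vertex-index v))
    ... | no missed = ⊥-elim (<-irrefl refl (≤-<-trans
      (injection⇒∣p∣≤∣q∣ σ (λ i∈L → x∈p∧x≢y⇒x∈p-y (σ∈T i∈L) λ σi≡v → missed (_ , i∈L , σi≡v)) σ-injective)
      (x∈p⇒∣p-x∣<∣p∣ (∈aliveSet v v-alive))))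

record Obstruction (n : ℕ) (F : FaultSet n) : Set where
  field
    I S        : Subset (2 ^ n)
    ∣S∣<∣I∣    : ∣ S ∣ < ∣ I ∣
    I-alive    : ∀ {x} → x ∈ₛ I → Alive F (vertex x)
    I∩S-empty  : ∀ {x} → x ∈ₛ I → x ∉ₛ S
    I-stranded : ∀ {x w} → x ∈ₛ I → w ∉ₛ S → ¬ EdgeIn n F (vertex x) (vertex w)

module _ {n : ℕ} (F : FaultSet n) where

  open Hall (survivingEdges F)

  deficiency⇒Obstruction : ∀ X → X ⊆ aliveSet F → ∣ N X ∩ aliveSet F ∣ < ∣ X ∣ → Obstruction n F
  deficiency⇒Obstruction X X⊆L deficient = record
    { I = I ; S = S
    ; ∣S∣<∣I∣ = +-cancelʳ-< (∣ M ∩ X ∣) (∣ S ∣) (∣ I ∣) (begin-strict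
        ∣ S ∣ + ∣ M ∩ X ∣ ≡⟨ ∣p─q∣+∣p∩q∣≡∣p∣ M X ⟩
        ∣ M ∣             <⟨ deficient ⟩
        ∣ X ∣             ≡⟨ sym (∣p─q∣+∣p∩q∣≡∣p∣ X M) ⟩
        ∣ I ∣ + ∣ X ∩ M ∣ ≡⟨ cong (λ A → ∣ I ∣ + ∣ A ∣) (∩-comm X M) ⟩
        ∣ I ∣ + ∣ M ∩ X ∣ ∎)
    ; I-alive = ∈⟦⟧⁻ (alive? F ∘ vertex) ∘ X⊆L ∘ inX
    ; I∩S-empty = λ x∈I x∈S → notM x∈I (proj₁ (x∈p─q⁻ M X x∈S))
    ; I-stranded = stranded
    }
    where
    open ≤-Reasoning
    L M I S : Subset (2 ^ n)
    L = aliveSet F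
    M = N X ∩ L
    I = X ─ M
    S = M ─ X
    inX : ∀ {x} → x ∈ₛ I → x ∈ₛ X
    inX = proj₁ ∘ x∈p─q⁻ X M
    notM : ∀ {x} → x ∈ₛ I → x ∉ₛ M
    notM = proj₂ ∘ x∈p─q⁻ X M

    stranded : ∀ {x w} → x ∈ₛ I → w ∉ₛ S → ¬ EdgeIn n F (vertex x) (vertex w)
    stranded {x} {w} x∈I w∉S xw with w ∈ₛ? X
    ... | yes w∈X = notM x∈I (x∈p∩q⁺ (∈-neighbourhood⁺ (survivingEdges F) w∈X
                     (∈⟦⟧⁺ (edgeIn? F (vertex w) ∘ vertex) (EdgeIn-sym F xw)) , X⊆L (inX x∈I)))
    ... | no w∉X = w∉S (x∈p∧x∉q⇒x∈p─q (x∈p∩q⁺ (∈-neighbourhood⁺ (survivingEdges F) (inX x∈I)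
                     (∈⟦⟧⁺ (edgeIn? F (vertex x) ∘ vertex) xw) ,
                     ∈⟦⟧⁺ (alive? F ∘ vertex) (proj₁ (proj₂ (proj₂ xw))))) w∉X)

  FPM⊎Obstruction : FracPerfectMatching n F ⊎ Obstruction n F
  FPM⊎Obstruction with anySubset? (λ X → X ⊆? aliveSet F ×-dec ∣ N X ∩ aliveSet F ∣ <? ∣ X ∣)
  ... | yes (X , X⊆L , deficient) = inj₂ (deficiency⇒Obstruction X X⊆L deficient)
  ... | no noDeficiency = inj₁ (EdgePermutation⇒FPM (matching⇒EdgePermutation F
          (hall′ (aliveSet F) (aliveSet F) λ X X⊆L → ≮⇒≥ λ deficient → noDeficiency (X , X⊆L , deficient))))

-- Faults forced by an obstruction

Straddles : ∀ {n} → Subset n → Fin n × Fin n → Set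
Straddles M (a , b) = (a ∈ₛ M × b ∉ₛ M) ⊎ (b ∈ₛ M × a ∉ₛ M)

straddles? : ∀ {n} (M : Subset n) e → Dec (Straddles M e)
straddles? M (a , b) = (a ∈ₛ? M ×-dec ¬? (b ∈ₛ? M)) ⊎-dec (b ∈ₛ? M ×-dec ¬? (a ∈ₛ? M))

module _ {n : ℕ} {F : FaultSet n} (ob : Obstruction n F) where

  open Obstruction ob

  indexPair : V n × V n → Fin (2 ^ n) × Fin (2 ^ n)
  indexPair (u , v) = index u , index v

  faultyPairs : List (Fin (2 ^ n) × Fin (2 ^ n))
  faultyPairs = List.map indexPair (es F)

  strays : Subset (2 ^ n)
  strays = neighbourhood (adjacency n) I ─ I ─ S

  faultyPair : ∀ {x w} → (vertex x , vertex w) ∈ es F → (x , w) ∈ faultyPairs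
  faultyPair {x} {w} xw∈ =
    subst₂ (λ a b → (a , b) ∈ faultyPairs) (index-vertex {n} x) (index-vertex {n} w) (∈-map⁺ indexPair xw∈)

  edgeFromI-faulty : ∀ {x w} → x ∈ₛ I → w ∉ₛ S → Alive F (vertex w) → w ∈ₛ adjacency n x →
                     (x , w) ∈ faultyPairs ⊎ (w , x) ∈ faultyPairs
  edgeFromI-faulty {x} {w} x∈I w∉S w-alive w∈adj
    with faultyEdge? F (vertex x , vertex w) | faultyEdge? F (vertex w , vertex x)
  ... | yes xw∈ | _ = inj₁ (faultyPair xw∈)
  ... | no _ | yes wx∈ = inj₂ (faultyPair wx∈)
  ... | no xw∉ | no wx∉ = ⊥-elim (I-stranded x∈I w∉S
          (∈⟦⟧⁻ (λ j → T? (adjB n (vertex x) (vertex j))) w∈adj , I-alive x∈I , w-alive , xw∉ , wx∉))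

  innerEdges≤faults : innerEdgeCount (adjacency n) I ≤ length (filter (inside? I) faultyPairs)
  innerEdges≤faults = innerEdgeCount≤ (adjacency n) faultyPairs I
    λ i∈I j∈I j∈adj → edgeFromI-faulty i∈I (I∩S-empty j∈I) (I-alive j∈I) j∈adj

  -- a stray vertex is a faulty vertex or the outer end of a faulty edge leaving I
  strays≤faults : ∣ strays ∣ ≤ length (vs F) + length (filter (straddles? I) faultyPairs)
  strays≤faults = begin
    ∣ strays ∣
      ≤⟨ cover⇒∣p∣≤length Witness witness? witnesses strays covered unique ⟩
    length witnesses
      ≡⟨ trans (length-++ (List.map inj₁ (vs F)))
               (cong₂ _+_ (length-map inj₁ (vs F)) (length-map inj₂ (filter (straddles? I) faultyPairs))) ⟩
    length (vs F) + length (filter (straddles? I) faultyPairs) ∎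
    where
    open ≤-Reasoning
    Witness : Fin (2 ^ n) → V n ⊎ (Fin (2 ^ n) × Fin (2 ^ n)) → Set
    Witness w (inj₁ u) = index u ≡ w
    Witness w (inj₂ (a , b)) = (b ≡ w × a ∈ₛ I) ⊎ (a ≡ w × b ∈ₛ I)

    witness? : ∀ w y → Dec (Witness w y)
    witness? w (inj₁ u) = index u ≟ᶠ w
    witness? w (inj₂ (a , b)) = (b ≟ᶠ w ×-dec a ∈ₛ? I) ⊎-dec (a ≟ᶠ w ×-dec b ∈ₛ? I)

    witnesses : List (V n ⊎ (Fin (2 ^ n) × Fin (2 ^ n)))
    witnesses = List.map inj₁ (vs F) ++ List.map inj₂ (filter (straddles? I) faultyPairs)

    notI : ∀ {w} → w ∈ₛ strays → w ∉ₛ I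
    notI w∈ = proj₂ (x∈p─q⁻ _ I (proj₁ (x∈p─q⁻ _ S w∈)))

    covered : ∀ {w} → w ∈ₛ strays → ∃ λ y → y ∈ witnesses × Witness w y
    covered {w} w∈ with x∈p─q⁻ _ S w∈
    ... | w∈N─I , w∉S with x∈p─q⁻ _ I w∈N─I | faultyVertex? F (vertex w)
    ... | _ , _ | yes dead = inj₁ (vertex w) , ∈-++⁺ˡ (∈-map⁺ inj₁ dead) , index-vertex {n} w
    ... | w∈N , w∉I | no w-alive with ∈-neighbourhood⁻ (adjacency n) w∈N
    ... | x , x∈I , w∈adj with edgeFromI-faulty x∈I w∉S w-alive w∈adj
    ... | inj₁ xw∈ = inj₂ (x , w) , ∈-++⁺ʳ _ (∈-map⁺ inj₂ (∈-filter⁺ (straddles? I) xw∈ (inj₁ (x∈I , w∉I))))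
                     , inj₁ (refl , x∈I)
    ... | inj₂ wx∈ = inj₂ (w , x) , ∈-++⁺ʳ _ (∈-map⁺ inj₂ (∈-filter⁺ (straddles? I) wx∈ (inj₂ (x∈I , w∉I))))
                     , inj₂ (refl , x∈I)

    unique : ∀ {w w′ y} → w ∈ₛ strays → w′ ∈ₛ strays → Witness w y → Witness w′ y → w ≡ w′
    unique {y = inj₁ _} _ _ refl refl = refl
    unique {y = inj₂ _} _ _ (inj₁ (refl , _)) (inj₁ (refl , _)) = refl
    unique {y = inj₂ _} _ _ (inj₂ (refl , _)) (inj₂ (refl , _)) = refl
    unique {y = inj₂ _} w∈ _ (inj₁ (refl , _)) (inj₂ (_ , w∈I)) = ⊥-elim (notI w∈ w∈I)
    unique {y = inj₂ _} w∈ _ (inj₂ (refl , _)) (inj₁ (_ , w∈I)) = ⊥-elim (notI w∈ w∈I)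

  Obstruction⇒faults : innerEdgeCount (adjacency n) I + ∣ neighbourhood (adjacency n) I ─ I ∣ ≤ size F + ∣ S ∣
  Obstruction⇒faults = begin
    inner + ∣ N ─ I ∣
      ≤⟨ +-monoʳ-≤ inner (≤-trans (p⊆q⇒∣p∣≤∣q∣ N─I⊆strays∪S) (∣p∪q∣≤∣p∣+∣q∣ strays S)) ⟩
    inner + (∣ strays ∣ + ∣ S ∣)
      ≡⟨ trans (sym (+-assoc inner _ _)) (cong (_+ ∣ S ∣) (+-comm inner ∣ strays ∣)) ⟩
    ∣ strays ∣ + inner + ∣ S ∣
      ≤⟨ +-monoˡ-≤ ∣ S ∣ (+-mono-≤ strays≤faults innerEdges≤faults) ⟩
    length (vs F) + length (filter (straddles? I) faultyPairs) + length (filter (inside? I) faultyPairs) + ∣ S ∣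
      ≡⟨ cong (_+ ∣ S ∣) (+-assoc (length (vs F)) _ _) ⟩
    length (vs F) + (length (filter (straddles? I) faultyPairs) + length (filter (inside? I) faultyPairs)) + ∣ S ∣
      ≤⟨ +-monoˡ-≤ ∣ S ∣ (+-monoʳ-≤ (length (vs F))
           (length-filter-partition (straddles? I) (inside? I) straddles∩inside faultyPairs)) ⟩
    length (vs F) + length faultyPairs + ∣ S ∣
      ≡⟨ cong (λ k → length (vs F) + k + ∣ S ∣) (length-map indexPair (es F)) ⟩
    size F + ∣ S ∣ ∎
    where
    open ≤-Reasoning
    N : Subset (2 ^ n)
    N = neighbourhood (adjacency n) I
    inner : ℕ
    inner = innerEdgeCount (adjacency n) I

    N─I⊆strays∪S : N ─ I ⊆ strays ∪ S
    N─I⊆strays∪S {j} j∈ with j ∈ₛ? S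
    ... | yes j∈S = x∈p∪q⁺ (inj₂ j∈S)
    ... | no j∉S = x∈p∪q⁺ (inj₁ (x∈p∧x∉q⇒x∈p─q j∈ j∉S))

    straddles∩inside : ∀ {e} → Straddles I e → Inside I e → ⊥
    straddles∩inside (inj₁ (_ , b∉I)) (_ , b∈I) = b∉I b∈I
    straddles∩inside (inj₂ (_ , a∉I)) (a∈I , _) = a∉I a∈I

-- AQ_4

expansionBound : ℕ → ℕ
expansionBound zero = 0
expansionBound (suc zero) = 7
expansionBound (suc (suc k)) = k + 9

expansionTest : Subset 16 → Profile 16 → Bool
expansionTest _ P = expansionBound ∣ members P ∣ ≤ᵇ innerEdges P + ∣ neighbours P ─ members P ∣

-- by evaluation over all 2^16 vertex sets
AQ4-expansion : ∀ I → expansionBound ∣ I ∣ ≤ innerEdgeCount (adjacency 4) I + ∣ neighbourhood (adjacency 4) I ─ I ∣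
AQ4-expansion I =
  subst (λ M → expansionBound ∣ M ∣ ≤ innerEdgeCount (adjacency 4) I + ∣ neighbourhood (adjacency 4) I ─ M ∣)
  (members-allFin (adjacency 4) I)
  (≤ᵇ⇒≤ _ _ (Equivalence.from T-≡ (every-sound (adjacency 4) (allFin 16) expansionTest refl I)))

AQ4-degree : ∀ v → degree 4 v ≡ 7
AQ4-degree v = subst (λ u → degree 4 u ≡ 7) (vertex-index v)
  (toWitness {a? = all? λ i → degree 4 (vertex {4} i) ≟ 7} _ (index v))

AQ4-minDegree : IsMinDegree 4 7
AQ4-minDegree = (λ v → ≤-reflexive (sym (AQ4-degree v))) , (vertex {4} zero , AQ4-degree (vertex zero))

obstruction-size : ∀ {s i t} → t < i → expansionBound i ≤ s + t → 7 ≤ s × (s ≡ 7 → i ≡ 1 × t ≡ 0)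
obstruction-size {s} {suc zero} {zero} _ bound = subst (7 ≤_) (+-identityʳ s) bound , λ _ → refl , refl
obstruction-size {i = suc zero} {suc _} (s≤s ()) _
obstruction-size {s} {suc (suc k)} {t} t<i bound = ≤-trans (n≤1+n 7) 8≤s , λ { refl → ⊥-elim (<-irrefl refl 8≤s) }
  where
  8≤s : 8 ≤ s
  8≤s = +-cancelʳ-≤ (suc k) 8 s (begin
    8 + suc k ≡⟨ +-suc 8 k ⟩
    9 + k     ≡⟨ +-comm 9 k ⟩
    k + 9     ≤⟨ bound ⟩
    s + t     ≤⟨ +-monoʳ-≤ s (≤-pred t<i) ⟩
    s + suc k ∎)
    where open ≤-Reasoning

AQ4-Obstruction : ∀ {F} → Obstruction 4 F → 7 ≤ size F × (size F ≡ 7 → HasIsolatedVertex 4 F)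
AQ4-Obstruction {F} ob = proj₁ sizes , isolated ∘ proj₂ sizes
  where
  open Obstruction ob
  sizes : 7 ≤ size F × (size F ≡ 7 → ∣ I ∣ ≡ 1 × ∣ S ∣ ≡ 0)
  sizes = obstruction-size ∣S∣<∣I∣ (≤-trans (AQ4-expansion I) (Obstruction⇒faults ob))

  isolated : ∣ I ∣ ≡ 1 × ∣ S ∣ ≡ 0 → HasIsolatedVertex 4 F
  isolated (∣I∣≡1 , ∣S∣≡0) = vertex x , I-alive x∈I , λ u xu →
    I-stranded {w = index u} x∈I (λ i∈S → <-irrefl (sym ∣S∣≡0) (x∈p⇒0<∣p∣ i∈S))
      (subst (EdgeIn 4 F (vertex x)) (sym (vertex-index u)) xu)
    where
    x : Fin 16
    x = proj₁ (0<∣p∣⇒nonempty I (subst (0 <_) (sym ∣I∣≡1) (s≤s z≤n)))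
    x∈I : x ∈ₛ I
    x∈I = proj₂ (0<∣p∣⇒nonempty I (subst (0 <_) (sym ∣I∣≡1) (s≤s z≤n)))

AQ4-FSMP : ∀ F → IsFSMP 4 F → 7 ≤ size F × (size F ≡ 7 → HasIsolatedVertex 4 F)
AQ4-FSMP F fsmp = [ ⊥-elim ∘ fsmp , AQ4-Obstruction ]′ (FPM⊎Obstruction F)

AQ4-fsmp : IsFsmpNumber 4 7
AQ4-fsmp =
  (neighbourhoodFault 4 v₀ , isolated⇒FSMP (neighbourhoodFault-isolates 4 v₀) , trans (+-identityʳ _) (AQ4-degree v₀)) ,
  λ F fsmp → proj₁ (AQ4-FSMP F fsmp)
  where
  v₀ : V 4
  v₀ = vertex zero

lemma4p1 : FracStronglyMaximallyMatched 4 × FracStronglySuperMatched 4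
lemma4p1 = (7 , AQ4-fsmp , AQ4-minDegree) , (7 , AQ4-fsmp , AQ4-minDegree , λ F fsmp → proj₂ (AQ4-FSMP F fsmp))
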